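{- For every oriented graph $D$, \[ \operatorname{hn}(D) \leq |\operatorname{Ext}(D)| + \frac{2}{3}\,|V(D) \setminus \operatorname{Ext}(D)|. \]
   Context: An oriented graph $D$ is an orientation of a finite simple graph, i.e. a digraph with no loops, no multiple arcs and no pair of opposite arcs. A $(u,v)$-path is a directed path from $u$ to $v$, and a $(u,v)$-geodesic is a $(u,v)$-path with the minimum number of arcs. For $S \subseteq V(D)$ with $|S| \geq 2$, $I(S)$ is the set of all vertices lying on some $(u,v)$-geodesic with $u,v \in S$ (endpoints included); if $|S| \leq 1$ then $I(S) = S$. A set $S$ is convex if $I(S) = S$. The (convex) hull $[S]$ of $S$ is the smallest convex set containing $S$. $S$ is a hull set of $D$ if $[S] = V(D)$, and $\operatorname{hn}(D)$ (the hull number) is the minimum cardinality of a hull set of $D$. For $v \in V(D)$, $N^-(v)$ and $N^+(v)$ are its in- and out-neighbourhoods and $d^-(v), d^+(v)$ their sizes. A vertex $v$ is extreme if it is a transmitter ($d^-(v) = 0$), a receiver ($d^+(v) = 0$), or transitive ($d^-(v) > 0$, $d^+(v) > 0$, and $(u,w) \in A(D)$ for every $u \in N^-(v)$ and $w \in N^+(v)$). $\operatorname{Ext}(D)$ denotes the set of extreme vertices of $D$. -}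

module Defs where

open import Data.Nat using (ℕ; _≤_; _∸_)
open import Data.Bool using (Bool; true; false)
open import Data.Fin using (Fin)
open import Data.Fin.Subset using (Subset; _∈_; _⊆_; ∣_∣)
open import Data.List using (List; []; _∷_; length)
open import Data.List.Relation.Unary.Unique.Propositional using (Unique)
import Data.List.Membership.Propositional as LM
open import Data.Product using (Σ; _×_; ∃; ∃-syntax)
open import Data.Sum using (_⊎_)
open import Relation.Binary.PropositionalEquality using (_≡_)
open import Relation.Nullary using (¬_)

-- An oriented graph on the vertex set Fin n, given by its (Boolean) arc relation:
-- no loops, no pair of opposite arcs (multiple arcs are impossible for a relation).
record OrientedGraph (n : ℕ) : Set where
  field
    arc         : Fin n → Fin n → Bool
    irreflexive : ∀ v → arc v v ≡ false
    asymmetric  : ∀ u v → arc u v ≡ true → arc v u ≡ false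

module _ {n : ℕ} (D : OrientedGraph n) where
  open OrientedGraph D

  Arc : Fin n → Fin n → Set
  Arc u v = arc u v ≡ true

  data Walk : Fin n → Fin n → List (Fin n) → Set where
    here : ∀ {u} → Walk u u (u ∷ [])
    step : ∀ {u w v p} → Arc u w → Walk w v p → Walk u v (u ∷ p)

  Path : Fin n → Fin n → List (Fin n) → Set
  Path u v p = Walk u v p × Unique p

  -- A (u,v)-geodesic: a (u,v)-path with the minimum number of arcs
  -- (number of arcs = number of vertices - 1, so we compare list lengths).
  Geodesic : Fin n → Fin n → List (Fin n) → Set
  Geodesic u v p = Path u v p × (∀ q → Path u v q → length p ≤ length q)

  -- w ∈ I(S): w lies on some (u,v)-geodesic with u, v ∈ S (endpoints included).
  -- (For |S| ≤ 1 this yields I(S) = S, matching the convention.)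
  InInterval : Subset n → Fin n → Set
  InInterval S w = ∃[ u ] ∃[ v ] ∃[ p ] (u ∈ S × v ∈ S × Geodesic u v p × w LM.∈ p)

  Convex : Subset n → Set
  Convex S = ∀ w → InInterval S w → w ∈ S

  IsHull : Subset n → Subset n → Set
  IsHull S T = Convex T × S ⊆ T × (∀ C → Convex C → S ⊆ C → T ⊆ C)

  HullSet : Subset n → Set
  HullSet S = Σ (Subset n) λ T → IsHull S T × (∀ w → w ∈ T)

  Transmitter : Fin n → Set
  Transmitter v = ∀ u → ¬ Arc u v

  Receiver : Fin n → Set
  Receiver v = ∀ w → ¬ Arc v w

  Transitive : Fin n → Set
  Transitive v = (∃[ u ] Arc u v) × (∃[ w ] Arc v w)
               × (∀ u w → Arc u v → Arc v w → Arc u w)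

  Extreme : Fin n → Set
  Extreme v = Transmitter v ⊎ Receiver v ⊎ Transitive v

module Submission where

-- Call v inner if it is the middle of an induced path u → v → w (the arc u → w
-- is missing).  Such a path is a (u,w)-geodesic, so every convex set containing
-- u and w contains v; moreover every non-extreme vertex is inner.
-- Fix for each inner vertex one such pair (u , w) of "parents".  A set R of inner
-- vertices is peelable if the parents of each v ∈ R lie outside R or after v in
-- the vertex order; then a downward induction shows that V ∖ R is a hull set.
-- A greedy 3-colouring (each vertex avoids the colours of its earlier parents)
-- splits the inner vertices into three peelable colour classes, and the largest
-- one contains at least a third of the non-extreme vertices.  Removing it from V
-- gives the required hull set.

open import Defs
open import Data.Nat using (ℕ; _≤_; _+_; _*_; _∸_)
open import Data.Fin using (Fin)
open import Data.Fin.Subset using (Subset; _∈_; ∣_∣)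
open import Data.Product using (Σ; _×_)
open import Function.Bundles using (_⇔_)

open import Data.Nat using (z≤n; s≤s)
import Data.Nat as ℕ
open import Data.Nat.Properties
  using (≤-refl; ≤-trans; ≤-total; +-mono-≤; +-monoʳ-≤; +-suc; ≤∧≢⇒<;
         *-distribˡ-∸; ∸-monoʳ-≤; m∸n+n≡m; m+n∸n≡m; module ≤-Reasoning)
open import Data.Nat.Solver using (module +-*-Solver)
open import Data.Fin using (zero; suc; toℕ; _<_; _>_)
open import Data.Fin.Properties using (any?; <-cmp)
open import Data.Fin.Induction using (>-wellFounded)
import Data.Fin.Properties as Fin
open import Data.Fin.Subset using (_⊆_; _∪_; ∁; ⊤; inside; outside)
open import Data.Fin.Subset.Properties
  using (_∈?_; ∈⊤; x∉p⇒x∈∁p; x∈∁p⇒x∉p; x∈p∪q⁺; p⊆q⇒∣p∣≤∣q∣; ∣p∣≤n; ∣p∣≤∣x∷p∣;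
         ∣∁p∣≡n∸∣p∣)
open import Data.Bool using (true)
import Data.Bool.Properties as Bool
open import Data.Vec using (tabulate; []; _∷_)
open import Data.Vec.Properties using (lookup∘tabulate; []=⇒lookup; lookup⇒[]=)
open import Data.List using ([]; _∷_; length)
open import Data.List.Relation.Unary.Any using (here; there)
open import Data.List.Relation.Unary.All using ([]; _∷_)
open import Data.List.Relation.Unary.AllPairs using ([]; _∷_)
open import Data.Product using (_,_; proj₁; proj₂; ∃; ∃-syntax)
open import Data.Sum using (_⊎_; inj₁; inj₂)
open import Function using (_∘_)
open import Function.Bundles using (Equivalence; mk⇔)
open import Induction.WellFounded using (Acc; acc)
open import Relation.Binary.Definitions using (tri<; tri≈; tri>)
open import Relation.Binary.PropositionalEquality
  using (_≡_; _≢_; refl; sym; trans; cong; subst; module ≡-Reasoning)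
open import Relation.Nullary using (¬_; Dec; yes; no; does; ¬?; contradiction)
open import Relation.Nullary.Decidable using (_×-dec_; toWitness; isYes≗does; dec-true; decidable-stable)
open import Relation.Unary using (Pred; Decidable)

⟦_⟧ : ∀ {n ℓ} {P : Pred (Fin n) ℓ} → Decidable P → Subset n
⟦ P? ⟧ = tabulate (λ v → does (P? v))

∈⟦⟧⇔ : ∀ {n ℓ} {P : Pred (Fin n) ℓ} (P? : Decidable P) {v : Fin n} → v ∈ ⟦ P? ⟧ ⇔ P v
∈⟦⟧⇔ P? {v} = mk⇔
  (λ v∈ → toWitness (Equivalence.from Bool.T-≡ (trans (isYes≗does (P? v))
            (trans (sym (lookup∘tabulate _ v)) ([]=⇒lookup v∈)))))
  (λ p → lookup⇒[]= v _ (trans (lookup∘tabulate _ v) (dec-true (P? v) p)))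

∣p∪q∣≤∣p∣+∣q∣ : ∀ {n} (p q : Subset n) → ∣ p ∪ q ∣ ≤ ∣ p ∣ + ∣ q ∣
∣p∪q∣≤∣p∣+∣q∣ []            []            = z≤n
∣p∪q∣≤∣p∣+∣q∣ (outside ∷ p) (outside ∷ q) = ∣p∪q∣≤∣p∣+∣q∣ p q
∣p∪q∣≤∣p∣+∣q∣ (outside ∷ p) (inside  ∷ q) =
  subst (ℕ.suc ∣ p ∪ q ∣ ≤_) (sym (+-suc ∣ p ∣ ∣ q ∣)) (s≤s (∣p∪q∣≤∣p∣+∣q∣ p q))
∣p∪q∣≤∣p∣+∣q∣ (inside  ∷ p) (x       ∷ q) =
  s≤s (≤-trans (∣p∪q∣≤∣p∣+∣q∣ p q) (+-monoʳ-≤ ∣ p ∣ (∣p∣≤∣x∷p∣ x q)))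

⋃₃ : ∀ {n} → (Fin 3 → Subset n) → Subset n
⋃₃ K = K zero ∪ K (suc zero) ∪ K (suc (suc zero))

Σ₃ : (Fin 3 → ℕ) → ℕ
Σ₃ f = f zero + (f (suc zero) + f (suc (suc zero)))

∈⋃₃ : ∀ {n} (K : Fin 3 → Subset n) {v} i → v ∈ K i → v ∈ ⋃₃ K
∈⋃₃ K zero             v∈ = x∈p∪q⁺ (inj₁ v∈)
∈⋃₃ K (suc zero)       v∈ = x∈p∪q⁺ (inj₂ (x∈p∪q⁺ (inj₁ v∈)))
∈⋃₃ K (suc (suc zero)) v∈ = x∈p∪q⁺ (inj₂ (x∈p∪q⁺ (inj₂ v∈)))

∣⋃₃∣≤Σ₃ : ∀ {n} (K : Fin 3 → Subset n) → ∣ ⋃₃ K ∣ ≤ Σ₃ (∣_∣ ∘ K)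
∣⋃₃∣≤Σ₃ K = ≤-trans (∣p∪q∣≤∣p∣+∣q∣ (K zero) _)
                    (+-monoʳ-≤ ∣ K zero ∣ (∣p∪q∣≤∣p∣+∣q∣ (K (suc zero)) (K (suc (suc zero)))))

argmax : ∀ {k} (f : Fin (ℕ.suc k) → ℕ) → ∃[ i ] (∀ j → f j ≤ f i)
argmax {ℕ.zero} f = zero , λ { zero → ≤-refl }
argmax {ℕ.suc k} f with argmax (f ∘ suc)
... | i , max with ≤-total (f zero) (f (suc i))
...   | inj₁ f0≤ = suc i , λ { zero → f0≤ ; (suc j) → max j }
...   | inj₂ ≤f0 = zero  , λ { zero → ≤-refl ; (suc j) → ≤-trans (max j) ≤f0 }

third-of-total : (f : Fin 3 → ℕ) → ∃[ i ] (Σ₃ f ≤ 3 * f i)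
third-of-total f with argmax f
... | i , max = i , subst (Σ₃ f ≤_) (three-times (f i))
                          (+-mono-≤ (max zero) (+-mono-≤ (max (suc zero)) (max (suc (suc zero)))))
  where
  open +-*-Solver
  three-times : ∀ m → m + (m + m) ≡ 3 * m
  three-times = solve 1 (λ m → m :+ (m :+ m) := con 3 :* m) refl

removal-bound : ∀ {n e k} → e ≤ n → n ∸ e ≤ 3 * k → 3 * (n ∸ k) ≤ 3 * e + 2 * (n ∸ e)
removal-bound {n} {e} {k} e≤n d≤3k = begin
  3 * (n ∸ k)              ≡⟨ *-distribˡ-∸ 3 n k ⟩
  3 * n ∸ 3 * k            ≤⟨ ∸-monoʳ-≤ (3 * n) d≤3k ⟩
  3 * n ∸ d                ≡⟨ cong (λ m → 3 * m ∸ d) (sym (m∸n+n≡m e≤n)) ⟩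
  3 * (d + e) ∸ d          ≡⟨ cong (_∸ d) (regroup d e) ⟩
  (3 * e + 2 * d) + d ∸ d  ≡⟨ m+n∸n≡m (3 * e + 2 * d) d ⟩
  3 * e + 2 * d            ∎
  where
  open ≤-Reasoning
  open +-*-Solver
  d : ℕ
  d = n ∸ e
  regroup : ∀ d e → 3 * (d + e) ≡ (3 * e + 2 * d) + d
  regroup = solve 2 (λ d e → con 3 :* (d :+ e) := (con 3 :* e :+ con 2 :* d) :+ d) refl

fresh : Fin 3 → Fin 3 → Fin 3
fresh zero             zero             = suc zero
fresh zero             (suc zero)       = suc (suc zero)
fresh zero             (suc (suc zero)) = suc zero
fresh (suc zero)       zero             = suc (suc zero)
fresh (suc (suc zero)) zero             = suc zero
fresh (suc _)          (suc _)          = zero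

fresh-new : ∀ a b → fresh a b ≢ a × fresh a b ≢ b
fresh-new zero             zero             = (λ ()) , (λ ())
fresh-new zero             (suc zero)       = (λ ()) , (λ ())
fresh-new zero             (suc (suc zero)) = (λ ()) , (λ ())
fresh-new (suc zero)       zero             = (λ ()) , (λ ())
fresh-new (suc (suc zero)) zero             = (λ ()) , (λ ())
fresh-new (suc zero)       (suc _)          = (λ ()) , (λ ())
fresh-new (suc (suc zero)) (suc _)          = (λ ()) , (λ ())

module GreedyColouring {n : ℕ} (parents : Fin n → Fin n × Fin n) where

  Parent : Fin n → Fin n → Set
  Parent x v = x ≡ proj₁ (parents v) ⊎ x ≡ proj₂ (parents v)

  -- After stage k the vertices of index < k carry their final colour.
  stage : ℕ → Fin n → Fin 3
  stage ℕ.zero    v = zero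
  stage (ℕ.suc k) v with toℕ v ℕ.≟ k
  ... | yes _ = fresh (stage k (proj₁ (parents v))) (stage k (proj₂ (parents v)))
  ... | no  _ = stage k v

  colour : Fin n → Fin 3
  colour v = stage (ℕ.suc (toℕ v)) v

  colour-unfold : ∀ v → colour v ≡ fresh (stage (toℕ v) (proj₁ (parents v)))
                                         (stage (toℕ v) (proj₂ (parents v)))
  colour-unfold v with toℕ v ℕ.≟ toℕ v
  ... | yes _  = refl
  ... | no neq = contradiction refl neq

  stage-final : ∀ k x → toℕ x ℕ.< k → stage k x ≡ colour x
  stage-final (ℕ.suc k) x x<k with toℕ x ℕ.≟ k
  ... | yes refl = sym (colour-unfold x)
  ... | no  x≢k  = stage-final k x (≤∧≢⇒< (ℕ.s≤s⁻¹ x<k) x≢k)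

  colour-proper : ∀ {x v} → Parent x v → x < v → colour x ≢ colour v
  colour-proper {x} {v} (inj₁ refl) x<v same = proj₁ (fresh-new _ _) (begin
    fresh (stage (toℕ v) x) _  ≡⟨ sym (colour-unfold v) ⟩
    colour v                  ≡⟨ sym same ⟩
    colour x                  ≡⟨ sym (stage-final (toℕ v) x x<v) ⟩
    stage (toℕ v) x           ∎)
    where open ≡-Reasoning
  colour-proper {x} {v} (inj₂ refl) x<v same = proj₂ (fresh-new _ _) (begin
    fresh _ (stage (toℕ v) x)  ≡⟨ sym (colour-unfold v) ⟩
    colour v                  ≡⟨ sym same ⟩
    colour x                  ≡⟨ sym (stage-final (toℕ v) x x<v) ⟩
    stage (toℕ v) x           ∎)
    where open ≡-Reasoning

  same-colour-parent-later : ∀ {x v} → Parent x v → x ≢ v → colour x ≡ colour v → v < x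
  same-colour-parent-later {x} {v} par x≢v same with <-cmp x v
  ... | tri< x<v _ _ = contradiction same (colour-proper par x<v)
  ... | tri≈ _ x≡v _ = contradiction x≡v x≢v
  ... | tri> _ _ v<x = v<x

module Hull {n : ℕ} (D : OrientedGraph n) where
  open OrientedGraph D

  arc? : ∀ u v → Dec (Arc D u v)
  arc? u v = arc u v Bool.≟ true

  arc⇒≢ : ∀ {u v} → Arc D u v → u ≢ v
  arc⇒≢ {u} uv refl with trans (sym uv) (irreflexive u)
  ... | ()

  arc⇒¬reverse : ∀ {u v} → Arc D u v → ¬ Arc D v u
  arc⇒¬reverse {u} {v} uv vu with trans (sym vu) (asymmetric u v uv)
  ... | ()

  Induced₂ : Fin n → Fin n → Fin n → Set
  Induced₂ u v w = Arc D u v × Arc D v w × ¬ Arc D u w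

  Inner : Fin n → Set
  Inner v = ∃[ u ] ∃[ w ] Induced₂ u v w

  inner? : Decidable Inner
  inner? v = any? λ u → any? λ w → arc? u v ×-dec arc? v w ×-dec ¬? (arc? u w)

  non-inner⇒extreme : ∀ v → ¬ Inner v → Extreme D v
  non-inner⇒extreme v ¬inner with any? (λ u → arc? u v) | any? (λ w → arc? v w)
  ... | no noIn | _        = inj₁ (λ u uv → noIn (u , uv))
  ... | yes _   | no noOut = inj₂ (inj₁ (λ w vw → noOut (w , vw)))
  ... | yes hasIn | yes hasOut = inj₂ (inj₂ (hasIn , hasOut , transitive))
    where
    transitive : ∀ u w → Arc D u v → Arc D v w → Arc D u w
    transitive u w uv vw = decidable-stable (arc? u w) (λ ¬uw → ¬inner (u , w , uv , vw , ¬uw))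

  three≤walk : ∀ {u w q} → u ≢ w → ¬ Arc D u w → Walk D u w q → 3 ≤ length q
  three≤walk u≢w ¬uw here                          = contradiction refl u≢w
  three≤walk u≢w ¬uw (step uw here)                = contradiction uw ¬uw
  three≤walk u≢w ¬uw (step _ (step _ here))        = s≤s (s≤s (s≤s z≤n))
  three≤walk u≢w ¬uw (step _ (step _ (step _ _)))  = s≤s (s≤s (s≤s z≤n))

  induced⇒geodesic : ∀ {u v w} → Induced₂ u v w → Geodesic D u w (u ∷ v ∷ w ∷ [])
  induced⇒geodesic {u} {v} {w} (uv , vw , ¬uw) =
    (step uv (step vw here) , (arc⇒≢ uv ∷ u≢w ∷ []) ∷ (arc⇒≢ vw ∷ []) ∷ [] ∷ [])
    , λ q path → three≤walk u≢w ¬uw (proj₁ path)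
    where
    u≢w : u ≢ w
    u≢w refl = arc⇒¬reverse uv vw

  induced⇒convex : ∀ {C u v w} → Convex D C → Induced₂ u v w → u ∈ C → w ∈ C → v ∈ C
  induced⇒convex convC p u∈C w∈C =
    convC _ (_ , _ , _ , u∈C , w∈C , induced⇒geodesic p , there (here refl))

  spanning⇒hullSet : ∀ {S} → (∀ C → Convex D C → S ⊆ C → ∀ v → v ∈ C) → HullSet D S
  spanning⇒hullSet spans =
    ⊤ , ((λ _ _ → ∈⊤) , (λ _ → ∈⊤) , (λ C convC S⊆C {v} _ → spans C convC S⊆C v)) , λ _ → ∈⊤

  Peelable : Subset n → Set
  Peelable R = ∀ v → v ∈ R → ∃[ u ] ∃[ w ] (Induced₂ u v w × (u ∈ R → v < u) × (w ∈ R → v < w))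

  peelable⇒hullSet : ∀ {R} → Peelable R → HullSet D (∁ R)
  peelable⇒hullSet {R} peel = spanning⇒hullSet (λ C convC ∁R⊆C v → regain C convC ∁R⊆C v (>-wellFounded v))
    where
    regain : ∀ C → Convex D C → ∁ R ⊆ C → ∀ v → Acc _>_ v → v ∈ C
    regain C convC ∁R⊆C v (acc later) with v ∈? R
    ... | no v∉R = ∁R⊆C (x∉p⇒x∈∁p v∉R)
    ... | yes v∈R with peel v v∈R
    ...   | u , w , p , u-later , w-later = induced⇒convex convC p (end u u-later) (end w w-later)
      where
      end : ∀ x → (x ∈ R → v < x) → x ∈ C
      end x x-later with x ∈? R
      ... | no x∉R = ∁R⊆C (x∉p⇒x∈∁p x∉R)
      ... | yes x∈R = regain C convC ∁R⊆C x (later (x-later x∈R))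

  parents : Fin n → Fin n × Fin n
  parents v with inner? v
  ... | yes (u , w , _) = u , w
  ... | no _            = v , v

  parents-induced : ∀ {v} → Inner v → Induced₂ (proj₁ (parents v)) v (proj₂ (parents v))
  parents-induced {v} inner with inner? v
  ... | yes (_ , _ , p) = p
  ... | no ¬inner      = contradiction inner ¬inner

  open GreedyColouring parents

  InClass : Fin 3 → Fin n → Set
  InClass i v = Inner v × colour v ≡ i

  class : Fin 3 → Subset n
  class i = ⟦ (λ v → inner? v ×-dec (colour v Fin.≟ i)) ⟧

  ∈class⇔ : ∀ {i v} → v ∈ class i ⇔ InClass i v
  ∈class⇔ {i} = ∈⟦⟧⇔ (λ v → inner? v ×-dec (colour v Fin.≟ i))

  -- A same-coloured parent of v differs from v, so by the greedy rule it comes later.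
  class-peelable : ∀ i → Peelable (class i)
  class-peelable i v v∈K with Equivalence.to ∈class⇔ v∈K
  ... | inner , colour-v = _ , _ , p , later (inj₁ refl) (arc⇒≢ (proj₁ p))
                                    , later (inj₂ refl) (arc⇒≢ (proj₁ (proj₂ p)) ∘ sym)
    where
    p : Induced₂ (proj₁ (parents v)) v (proj₂ (parents v))
    p = parents-induced inner
    later : ∀ {x} → Parent x v → x ≢ v → x ∈ class i → v < x
    later par x≢v x∈K = same-colour-parent-later par x≢v
      (trans (proj₂ (Equivalence.to ∈class⇔ x∈K)) (sym colour-v))

  -- Every non-extreme vertex is inner, hence lies in the class of its colour.
  non-extreme⊆classes : ∀ {E} → (∀ v → (v ∈ E) ⇔ Extreme D v) → ∁ E ⊆ ⋃₃ class
  non-extreme⊆classes {E} isExt {v} v∈∁E =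
    ∈⋃₃ class (colour v) (Equivalence.from ∈class⇔ (inner , refl))
    where
    inner : Inner v
    inner with inner? v
    ... | yes inner = inner
    ... | no ¬inner = contradiction (Equivalence.from (isExt v) (non-inner⇒extreme v ¬inner))
                                    (x∈∁p⇒x∉p v∈∁E)

theorem1 : (n : ℕ) (D : OrientedGraph n) (E : Subset n)
    → (∀ v → (v ∈ E) ⇔ Extreme D v)
    → Σ (Subset n) λ S → HullSet D S × (3 * ∣ S ∣ ≤ 3 * ∣ E ∣ + 2 * (n ∸ ∣ E ∣))
theorem1 n D E isExt = ∁ (class i) , peelable⇒hullSet (class-peelable i) , bound
  where
  open Hull D
  i : Fin 3
  i = proj₁ (third-of-total (∣_∣ ∘ class))
  non-extreme≤3|K| : n ∸ ∣ E ∣ ≤ 3 * ∣ class i ∣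
  non-extreme≤3|K| = begin
    n ∸ ∣ E ∣          ≡⟨ sym (∣∁p∣≡n∸∣p∣ E) ⟩
    ∣ ∁ E ∣            ≤⟨ p⊆q⇒∣p∣≤∣q∣ (non-extreme⊆classes isExt) ⟩
    ∣ ⋃₃ class ∣       ≤⟨ ∣⋃₃∣≤Σ₃ class ⟩
    Σ₃ (∣_∣ ∘ class)   ≤⟨ proj₂ (third-of-total (∣_∣ ∘ class)) ⟩
    3 * ∣ class i ∣    ∎
    where open ≤-Reasoning
  bound : 3 * ∣ ∁ (class i) ∣ ≤ 3 * ∣ E ∣ + 2 * (n ∸ ∣ E ∣)
  bound = subst (λ s → 3 * s ≤ _) (sym (∣∁p∣≡n∸∣p∣ (class i)))
                (removal-bound {k = ∣ class i ∣} (∣p∣≤n E) non-extreme≤3|K|)
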